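{- Let $t$ be a positive integer with $t\leq 2$ and let $n=3t$. Then $$\mathrm{va}_2^{\equiv}(K_{n,n+1})= 2\left\lfloor \frac{n+2}{3}\right\rfloor,$$ where $K_{n,n+1}$ is the complete bipartite graph with parts of sizes $n$ and $n+1$.
   Context: A $t$-coloring of a graph $G$ is any map $f:V(G)\to\{1,\dots,t\}$ (not necessarily proper), with color classes $V_i=f^{ -1}(i)$ (possibly empty); it is equitable if $||V_i|-|V_j||\le 1$ for all $i,j$. For a nonnegative integer $k$, a $(t,k)$-tree-coloring is a $t$-coloring such that every component of each induced subgraph $G[V_i]$ is a tree of maximum degree at most $k$. The strong equitable vertex $k$-arboricity $\mathrm{va}_k^{\equiv}(G)$ is the smallest positive integer $t$ such that $G$ has an equitable $(t',k)$-tree-coloring for every integer $t'\ge t$. -}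

module Defs where

open import Data.Nat using (ℕ; zero; suc; _+_; _≤_; _<_; _<ᵇ_)
open import Data.Fin as Fin using (Fin; toℕ)
open import Data.Bool using (Bool; true; false; if_then_else_; _∧_; _xor_)
open import Data.List using (List; map; allFin)
open import Data.Nat.ListAction using (sum)
open import Data.Product using (Σ; _×_)
open import Data.Sum using (_⊎_)
open import Relation.Nullary using (¬_)
open import Relation.Nullary.Decidable using (⌊_⌋)
open import Relation.Binary.PropositionalEquality using (_≡_)
open import Function.Definitions using (Injective)

Graph : ℕ → Set
Graph N = Fin N → Fin N → Bool

Adj : ∀ {N} → Graph N → Fin N → Fin N → Set
Adj G u v = G u v ≡ true

count : ∀ {N} → (Fin N → Bool) → ℕ
count {N} P = sum (map (λ v → if P v then 1 else 0) (allFin N))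

K : (n m : ℕ) → Graph (n + m)
K n m u v = (toℕ u <ᵇ n) xor (toℕ v <ᵇ n)

-- a t-coloring (not necessarily proper)
Coloring : ℕ → ℕ → Set
Coloring N t = Fin N → Fin t

classSize : ∀ {N t} → Coloring N t → Fin t → ℕ
classSize f i = count (λ v → ⌊ f v Fin.≟ i ⌋)

Equitable : ∀ {N t} → Coloring N t → Set
Equitable {t = t} f = (i j : Fin t) → classSize f i ≤ suc (classSize f j)

-- G contains a cycle all of whose vertices satisfy S:
-- distinct vertices g 0, ..., g (m-1), m ≥ 3, with g i ~ g (i+1) and g (m-1) ~ g 0
HasCycleIn : ∀ {N} → Graph N → (Fin N → Set) → Set
HasCycleIn {N} G S =
  Σ ℕ λ m → (3 ≤ m) × Σ (Fin m → Fin N) λ g →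
    Injective _≡_ _≡_ g × ((i : Fin m) → S (g i)) ×
    ((i j : Fin m) → (suc (toℕ i) ≡ toℕ j ⊎ (suc (toℕ i) ≡ m × toℕ j ≡ 0)) →
       Adj G (g i) (g j))

degIn : ∀ {N t} → Graph N → Coloring N t → Fin N → ℕ
degIn G f v = count (λ u → G v u ∧ ⌊ f u Fin.≟ f v ⌋)

-- (t,k)-tree-coloring: every component of each G[V_i] is a tree of max degree ≤ k,
-- i.e. each G[V_i] is acyclic (a forest) and has maximum degree ≤ k
TreeColoring : ∀ {N t} → Graph N → ℕ → Coloring N t → Set
TreeColoring {t = t} G k f =
  ((c : Fin t) → ¬ HasCycleIn G (λ v → f v ≡ c)) × (∀ v → degIn G f v ≤ k)

HasEqTreeColoring : ∀ {N} → Graph N → ℕ → ℕ → Set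
HasEqTreeColoring {N} G t k = Σ (Coloring N t) λ f → Equitable f × TreeColoring G k f

AllFrom : ∀ {N} → Graph N → ℕ → ℕ → Set
AllFrom G k t = (t' : ℕ) → t ≤ t' → HasEqTreeColoring G t' k

IsStrongEqVA : ∀ {N} → Graph N → ℕ → ℕ → Set
IsStrongEqVA G k m =
  (1 ≤ m) × AllFrom G k m × ((m' : ℕ) → 1 ≤ m' → m' < m → ¬ AllFrom G k m')

-- Upper bounds: explicit equitable colorings in which every class lies inside one side of the
-- bipartition (so it induces an edgeless graph), and, once t' is at least the number of vertices,
-- the coloring by singletons.
-- Lower bounds: in a (t,k)-tree-coloring of K_{n,m} a vertex sees every vertex of its class on the
-- other side, and two vertices of a class on each side would span a 4-cycle; so a class meeting
-- both sides has at most k + 1 vertices.  For k = 2 this rules out the single seven-vertex class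
-- of K_{3,4}.  An equitable 3-coloring of K_{6,7} has classes of sizes 4 and 5, which therefore
-- each lie on one side, and then the side of size 6 would be a sum of 4s and 5s.
module Submission where

open import Defs
open import Data.Nat using (ℕ; zero; suc; _+_; _*_; _≤_; _<_; _≤?_; _<ᵇ_; z≤n; s≤s; s≤s⁻¹)
open import Data.Nat.DivMod using (_/_)
open import Data.Nat.Properties
open import Data.Fin using (Fin; zero; suc; toℕ; _↑ˡ_; _↑ʳ_; inject≤; #_)
import Data.Fin.Properties as Finₚ
open import Data.Bool using (Bool; true; false; not; _∧_; _xor_; if_then_else_; T)
import Data.Bool.Properties as Boolₚ
open import Data.Vec using (Vec; []; _∷_; lookup)
open import Data.List using (allFin)
open import Data.List.Properties using (map-tabulate; map-cong)
open import Data.Nat.ListAction using (sum)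
open import Data.Product using (∃; ∃₂; _×_; _,_; proj₁; proj₂)
open import Data.Sum using (_⊎_; inj₁; inj₂; [_,_]′)
open import Data.Empty using (⊥; ⊥-elim)
open import Relation.Nullary using (¬_; Dec; yes; no; contradiction)
open import Relation.Nullary.Decidable using (⌊_⌋; ⌊⌋-map′; True; toWitness; _→-dec_; ¬?)
open import Relation.Binary.PropositionalEquality
open import Function using (_∘_; id)
open import Function.Bundles using (Equivalence)
open import Function.Definitions using (Injective)
open import Algebra.Properties.CommutativeSemigroup +-commutativeSemigroup using (interchange)

∑ : ∀ {k} → (Fin k → ℕ) → ℕ
∑ {zero}  g = 0
∑ {suc k} g = g zero + ∑ (g ∘ suc)

∑-cong : ∀ {k} {g h : Fin k → ℕ} → (∀ i → g i ≡ h i) → ∑ g ≡ ∑ h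
∑-cong {zero}  g≗h = refl
∑-cong {suc k} g≗h = cong₂ _+_ (g≗h zero) (∑-cong (g≗h ∘ suc))

∑-const : ∀ k x → ∑ {k} (λ _ → x) ≡ k * x
∑-const zero    x = refl
∑-const (suc k) x = cong (x +_) (∑-const k x)

∑-+ : ∀ {k} (g h : Fin k → ℕ) → ∑ (λ i → g i + h i) ≡ ∑ g + ∑ h
∑-+ {zero}  g h = refl
∑-+ {suc k} g h = trans (cong (g zero + h zero +_) (∑-+ (g ∘ suc) (h ∘ suc)))
                        (interchange (g zero) (h zero) (∑ (g ∘ suc)) (∑ (h ∘ suc)))

∑-mono-≤ : ∀ {k} {g h : Fin k → ℕ} → (∀ i → g i ≤ h i) → ∑ g ≤ ∑ h
∑-mono-≤ {zero}  g≤h = z≤n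
∑-mono-≤ {suc k} g≤h = +-mono-≤ (g≤h zero) (∑-mono-≤ (g≤h ∘ suc))

indicator : Bool → ℕ
indicator b = if b then 1 else 0

count-suc : ∀ {N} (P : Fin (suc N) → Bool) → count P ≡ indicator (P zero) + count (P ∘ suc)
count-suc P = cong (λ xs → indicator (P zero) + sum xs)
  (trans (map-tabulate suc (indicator ∘ P)) (sym (map-tabulate id (indicator ∘ P ∘ suc))))

count-cong : ∀ {N} {P Q : Fin N → Bool} → (∀ v → P v ≡ Q v) → count P ≡ count Q
count-cong {N} P≗Q = cong sum (map-cong (cong indicator ∘ P≗Q) (allFin N))

count-none : ∀ {N} (P : Fin N → Bool) → (∀ v → P v ≡ false) → count P ≡ 0
count-none {zero}  P none = refl
count-none {suc N} P none rewrite count-suc P | none zero = count-none (P ∘ suc) (none ∘ suc)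

count-++ : ∀ m n (P : Fin (m + n) → Bool) →
  count P ≡ count (P ∘ (_↑ˡ n)) + count (P ∘ (m ↑ʳ_))
count-++ zero    n P = refl
count-++ (suc m) n P rewrite count-suc P | count-suc (P ∘ (_↑ˡ n)) | count-++ m n (P ∘ suc) =
  sym (+-assoc (indicator (P zero)) _ _)

count-witness : ∀ {N} (P : Fin N → Bool) → 1 ≤ count P → ∃ λ v → T (P v)
count-witness {suc N} P 1≤count rewrite count-suc P with P zero in P0
... | true  = zero , subst T (sym P0) _
... | false = let (v , Pv) = count-witness (P ∘ suc) 1≤count in suc v , Pv

count-two-witnesses : ∀ {N} (P : Fin N → Bool) → 2 ≤ count P →
  ∃₂ λ v w → v ≢ w × T (P v) × T (P w)
count-two-witnesses {suc N} P 2≤count rewrite count-suc P with P zero in P0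
... | true  = let (w , Pw) = count-witness (P ∘ suc) (s≤s⁻¹ 2≤count) in
  zero , suc w , (λ ()) , subst T (sym P0) _ , Pw
... | false = let (v , w , v≢w , Pv , Pw) = count-two-witnesses (P ∘ suc) 2≤count in
  suc v , suc w , v≢w ∘ Finₚ.suc-injective , Pv , Pw

-- Each vertex lies in exactly one class, so Σ_c |V_c| = N follows by exchanging the sums.
∑-indicator-≟ : ∀ {k} (x : Fin k) → ∑ (λ c → indicator ⌊ x Finₚ.≟ c ⌋) ≡ 1
∑-indicator-≟ {suc k} zero    = cong suc (trans (∑-const k 0) (*-zeroʳ k))
∑-indicator-≟ {suc k} (suc x) =
  trans (∑-cong λ c → cong indicator (⌊⌋-map′ _ _ (x Finₚ.≟ c))) (∑-indicator-≟ x)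

∑-classSize : ∀ {N t} (f : Coloring N t) → ∑ (classSize f) ≡ N
∑-classSize {zero}  {t} f = trans (∑-const t 0) (*-zeroʳ t)
∑-classSize {suc N}     f = begin
  ∑ (classSize f)
    ≡⟨ ∑-cong (λ c → count-suc (λ v → ⌊ f v Finₚ.≟ c ⌋)) ⟩
  ∑ (λ c → indicator ⌊ f zero Finₚ.≟ c ⌋ + classSize (f ∘ suc) c)
    ≡⟨ ∑-+ (λ c → indicator ⌊ f zero Finₚ.≟ c ⌋) (classSize (f ∘ suc)) ⟩
  ∑ (λ c → indicator ⌊ f zero Finₚ.≟ c ⌋) + ∑ (classSize (f ∘ suc))
    ≡⟨ cong₂ _+_ (∑-indicator-≟ (f zero)) (∑-classSize (f ∘ suc)) ⟩
  suc N ∎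
  where open ≡-Reasoning

classSize-of-1-coloring : ∀ {N} (f : Coloring N 1) → classSize f zero ≡ N
classSize-of-1-coloring f = trans (sym (+-identityʳ _)) (∑-classSize f)

injective⇒classSize≤1 : ∀ {N t} {f : Coloring N t} → Injective _≡_ _≡_ f → ∀ c → classSize f c ≤ 1
injective⇒classSize≤1 {zero}          inj c = z≤n
injective⇒classSize≤1 {suc N} {f = f} inj c rewrite count-suc (λ v → ⌊ f v Finₚ.≟ c ⌋)
  with f zero Finₚ.≟ c
... | yes f0≡c = ≤-reflexive (cong suc (count-none _ other-color))
  where
    other-color : ∀ v → ⌊ f (suc v) Finₚ.≟ c ⌋ ≡ false
    other-color v with f (suc v) Finₚ.≟ c
    ... | yes fv≡c = contradiction (inj (trans fv≡c (sym f0≡c))) λ ()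
    ... | no  _    = refl
... | no  _ = injective⇒classSize≤1 (Finₚ.suc-injective ∘ inj) c

equitable⇒classSize-bounds : ∀ {N t} (f : Coloring N t) → Equitable f → ∀ c →
  N ≤ t * suc (classSize f c) × t * classSize f c ≤ t + N
equitable⇒classSize-bounds {N} {t} f equitable c = lower , upper
  where
    open ≤-Reasoning
    lower : N ≤ t * suc (classSize f c)
    lower = begin
      N                                 ≡⟨ ∑-classSize f ⟨
      ∑ (classSize f)                   ≤⟨ ∑-mono-≤ {h = λ _ → suc (classSize f c)} (λ j → equitable j c) ⟩
      ∑ {t} (λ _ → suc (classSize f c)) ≡⟨ ∑-const t _ ⟩
      t * suc (classSize f c)           ∎
    upper : t * classSize f c ≤ t + N
    upper = begin
      t * classSize f c                 ≡⟨ ∑-const t _ ⟨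
      ∑ {t} (λ _ → classSize f c)       ≤⟨ ∑-mono-≤ {h = λ j → 1 + classSize f j} (equitable c) ⟩
      ∑ (λ j → 1 + classSize f j)       ≡⟨ ∑-+ (λ _ → 1) (classSize f) ⟩
      ∑ {t} (λ _ → 1) + ∑ (classSize f) ≡⟨ cong₂ _+_ (trans (∑-const t 1) (*-identityʳ t)) (∑-classSize f) ⟩
      t + N                             ∎

equitable? : ∀ {N t} (f : Coloring N t) → Dec (Equitable f)
equitable? f = Finₚ.all? λ i → Finₚ.all? λ j → classSize f i ≤? suc (classSize f j)

Proper : ∀ {N t} → Graph N → Coloring N t → Set
Proper G f = ∀ u v → Adj G u v → f u ≢ f v

proper? : ∀ {N t} (G : Graph N) (f : Coloring N t) → Dec (Proper G f)
proper? G f = Finₚ.all? λ u → Finₚ.all? λ v →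
  (G u v Boolₚ.≟ true) →-dec ¬? (f u Finₚ.≟ f v)

module _ {N t} (G : Graph N) {f : Coloring N t} (proper : Proper G f) where

  proper⇒acyclic : ∀ c → ¬ HasCycleIn G (λ v → f v ≡ c)
  proper⇒acyclic c (zero , () , _)
  proper⇒acyclic c (suc zero , s≤s () , _)
  proper⇒acyclic c (suc (suc _) , _ , g , _ , g-colored , g-walk) =
    proper (g zero) (g (suc zero)) (g-walk zero (suc zero) (inj₁ refl))
      (trans (g-colored zero) (sym (g-colored (suc zero))))

  proper⇒degIn≡0 : ∀ v → degIn G f v ≡ 0
  proper⇒degIn≡0 v = count-none _ no-monochromatic-edge
    where
      no-monochromatic-edge : ∀ u → (G v u ∧ ⌊ f u Finₚ.≟ f v ⌋) ≡ false
      no-monochromatic-edge u with G v u in vu | f u Finₚ.≟ f v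
      ... | false | _         = refl
      ... | true  | no  _     = refl
      ... | true  | yes fu≡fv = contradiction (sym fu≡fv) (proper v u vu)

  proper⇒treeColoring : ∀ k → TreeColoring G k f
  proper⇒treeColoring k = proper⇒acyclic , λ v → subst (_≤ k) (sym (proper⇒degIn≡0 v)) z≤n

coloringTable : ∀ {N t} (G : Graph N) k (colors : Vec (Fin t) N) →
  {True (equitable? (lookup colors))} → {True (proper? G (lookup colors))} →
  HasEqTreeColoring G t k
coloringTable G k colors {equitable} {proper} =
  lookup colors , toWitness equitable , proper⇒treeColoring G (toWitness proper) k

injective⇒equitable : ∀ {N t} {f : Coloring N t} → Injective _≡_ _≡_ f → Equitable f
injective⇒equitable inj i j = ≤-trans (injective⇒classSize≤1 inj i) (s≤s z≤n)

injective⇒proper : ∀ {N t} (G : Graph N) {f : Coloring N t} → (∀ v → G v v ≡ false) →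
  Injective _≡_ _≡_ f → Proper G f
injective⇒proper G loopless inj u v uv fu≡fv with inj fu≡fv
... | refl = contradiction (trans (sym uv) (loopless u)) λ ()

hasEqTreeColoring-≥ : ∀ {N} (G : Graph N) → (∀ v → G v v ≡ false) →
  ∀ k {t} → N ≤ t → HasEqTreeColoring G t k
hasEqTreeColoring-≥ {N} G loopless k {t} N≤t =
  f , injective⇒equitable f-injective , proper⇒treeColoring G (injective⇒proper G loopless f-injective) k
  where
    f : Coloring N t
    f v = inject≤ v N≤t
    f-injective : Injective _≡_ _≡_ f
    f-injective = Finₚ.inject≤-injective N≤t N≤t _ _

positive-not-both≥2⇒one≡1 : ∀ x y → 1 ≤ x → 1 ≤ y → (2 ≤ x → 2 ≤ y → ⊥) → x ≡ 1 ⊎ y ≡ 1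
positive-not-both≥2⇒one≡1 1             _             _ _ _    = inj₁ refl
positive-not-both≥2⇒one≡1 (suc (suc _)) 1             _ _ _    = inj₂ refl
positive-not-both≥2⇒one≡1 (suc (suc _)) (suc (suc _)) _ _ both = ⊥-elim (both (s≤s (s≤s z≤n)) (s≤s (s≤s z≤n)))

isEven : ℕ → Bool
isEven zero    = true
isEven (suc k) = not (isEven k)

cycle-step-flips-parity : ∀ {ℓ} {x y : Fin ℓ} → isEven ℓ ≡ true →
  suc (toℕ x) ≡ toℕ y ⊎ (suc (toℕ x) ≡ ℓ × toℕ y ≡ 0) → isEven (toℕ y) ≡ not (isEven (toℕ x))
cycle-step-flips-parity even-ℓ (inj₁ x+1≡y)        = cong isEven (sym x+1≡y)
cycle-step-flips-parity even-ℓ (inj₂ (x+1≡ℓ , y≡0)) =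
  trans (cong isEven y≡0) (sym (trans (cong isEven x+1≡ℓ) even-ℓ))

module CompleteBipartite (n m : ℕ) where

  side : Fin (n + m) → Bool
  side v = toℕ v <ᵇ n

  side-↑ˡ : ∀ i → side (i ↑ˡ m) ≡ true
  side-↑ˡ i = trans (cong (_<ᵇ n) (Finₚ.toℕ-↑ˡ i m)) (Equivalence.to Boolₚ.T-≡ (<⇒<ᵇ (Finₚ.toℕ<n i)))

  side-↑ʳ : ∀ j → side (n ↑ʳ j) ≡ false
  side-↑ʳ j = trans (cong (_<ᵇ n) (Finₚ.toℕ-↑ʳ n j)) (k+x≮ᵇk n (toℕ j))
    where
      k+x≮ᵇk : ∀ k x → (k + x <ᵇ k) ≡ false
      k+x≮ᵇk zero    x = refl
      k+x≮ᵇk (suc k) x = k+x≮ᵇk k x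

  ↑ˡ≢↑ʳ : ∀ i j → i ↑ˡ m ≢ n ↑ʳ j
  ↑ˡ≢↑ʳ i j e = contradiction (trans (sym (side-↑ˡ i)) (trans (cong side e) (side-↑ʳ j))) λ ()

  K-loopless : ∀ v → K n m v v ≡ false
  K-loopless v = Boolₚ.xor-same (side v)

  onLeft : ∀ {t} → Coloring (n + m) t → Coloring n t
  onLeft f = f ∘ (_↑ˡ m)

  onRight : ∀ {t} → Coloring (n + m) t → Coloring m t
  onRight f = f ∘ (n ↑ʳ_)

  classSize-split : ∀ {t} (f : Coloring (n + m) t) c →
    classSize f c ≡ classSize (onLeft f) c + classSize (onRight f) c
  classSize-split f c = count-++ n m _

  degIn-↑ˡ : ∀ {t} (f : Coloring (n + m) t) i → degIn (K n m) f (i ↑ˡ m) ≡ classSize (onRight f) (f (i ↑ˡ m))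
  degIn-↑ˡ f i = trans (count-++ n m _) (cong₂ _+_
    (count-none _ λ i' → cong (_∧ same (i' ↑ˡ m)) (cong₂ _xor_ (side-↑ˡ i) (side-↑ˡ i')))
    (count-cong λ j → cong (_∧ same (n ↑ʳ j)) (cong₂ _xor_ (side-↑ˡ i) (side-↑ʳ j))))
    where
      same : Fin (n + m) → Bool
      same u = ⌊ f u Finₚ.≟ f (i ↑ˡ m) ⌋

  degIn-↑ʳ : ∀ {t} (f : Coloring (n + m) t) j → degIn (K n m) f (n ↑ʳ j) ≡ classSize (onLeft f) (f (n ↑ʳ j))
  degIn-↑ʳ f j = trans (count-++ n m _) (trans (cong₂ _+_
    (count-cong λ i → cong (_∧ same (i ↑ˡ m)) (cong₂ _xor_ (side-↑ʳ j) (side-↑ˡ i)))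
    (count-none _ λ j' → cong (_∧ same (n ↑ʳ j')) (cong₂ _xor_ (side-↑ʳ j) (side-↑ʳ j'))))
    (+-identityʳ _))
    where
      same : Fin (n + m) → Bool
      same u = ⌊ f u Finₚ.≟ f (n ↑ʳ j) ⌋

  K-4-cycle : ∀ {S : Fin (n + m) → Set} {i i' : Fin n} {j j' : Fin m} → i ≢ i' → j ≢ j' →
    S (i ↑ˡ m) → S (n ↑ʳ j) → S (i' ↑ˡ m) → S (n ↑ʳ j') → HasCycleIn (K n m) S
  K-4-cycle {S} {i} {i'} {j} {j'} i≢i' j≢j' S₀ S₁ S₂ S₃ =
    4 , s≤s (s≤s (s≤s z≤n)) , g , g-injective , g-in-S , g-walk
    where
      g : Fin 4 → Fin (n + m)
      g zero                   = i ↑ˡ m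
      g (suc zero)             = n ↑ʳ j
      g (suc (suc zero))       = i' ↑ˡ m
      g (suc (suc (suc zero))) = n ↑ʳ j'

      g-in-S : ∀ x → S (g x)
      g-in-S zero                   = S₀
      g-in-S (suc zero)             = S₁
      g-in-S (suc (suc zero))       = S₂
      g-in-S (suc (suc (suc zero))) = S₃

      side-g : ∀ x → side (g x) ≡ isEven (toℕ x)
      side-g zero                   = side-↑ˡ i
      side-g (suc zero)             = side-↑ʳ j
      side-g (suc (suc zero))       = side-↑ˡ i'
      side-g (suc (suc (suc zero))) = side-↑ʳ j'

      g-walk : ∀ x y → suc (toℕ x) ≡ toℕ y ⊎ (suc (toℕ x) ≡ 4 × toℕ y ≡ 0) → Adj (K n m) (g x) (g y)
      g-walk x y step = begin
        side (g x) xor side (g y)                     ≡⟨ cong₂ _xor_ (side-g x) (side-g y) ⟩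
        isEven (toℕ x) xor isEven (toℕ y)             ≡⟨ cong (isEven (toℕ x) xor_) (cycle-step-flips-parity refl step) ⟩
        isEven (toℕ x) xor not (isEven (toℕ x))       ≡⟨ Boolₚ.not-distribʳ-xor (isEven (toℕ x)) (isEven (toℕ x)) ⟨
        not (isEven (toℕ x) xor isEven (toℕ x))       ≡⟨ cong not (Boolₚ.xor-same (isEven (toℕ x))) ⟩
        true                                          ∎
        where open ≡-Reasoning

      g-injective : Injective _≡_ _≡_ g
      g-injective {zero}                   {zero}                   _ = refl
      g-injective {suc zero}               {suc zero}               _ = refl
      g-injective {suc (suc zero)}         {suc (suc zero)}         _ = refl
      g-injective {suc (suc (suc zero))}   {suc (suc (suc zero))}   _ = refl
      g-injective {zero}                   {suc (suc zero)}         e = contradiction (Finₚ.↑ˡ-injective m i i' e) i≢i'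
      g-injective {suc (suc zero)}         {zero}                   e = contradiction (Finₚ.↑ˡ-injective m i' i e) (i≢i' ∘ sym)
      g-injective {suc zero}               {suc (suc (suc zero))}   e = contradiction (Finₚ.↑ʳ-injective n j j' e) j≢j'
      g-injective {suc (suc (suc zero))}   {suc zero}               e = contradiction (Finₚ.↑ʳ-injective n j' j e) (j≢j' ∘ sym)
      g-injective {zero}                   {suc zero}               e = contradiction e (↑ˡ≢↑ʳ i j)
      g-injective {zero}                   {suc (suc (suc zero))}   e = contradiction e (↑ˡ≢↑ʳ i j')
      g-injective {suc (suc zero)}         {suc zero}               e = contradiction e (↑ˡ≢↑ʳ i' j)
      g-injective {suc (suc zero)}         {suc (suc (suc zero))}   e = contradiction e (↑ˡ≢↑ʳ i' j')
      g-injective {suc zero}               {zero}                   e = contradiction (sym e) (↑ˡ≢↑ʳ i j)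
      g-injective {suc zero}               {suc (suc zero)}         e = contradiction (sym e) (↑ˡ≢↑ʳ i' j)
      g-injective {suc (suc (suc zero))}   {zero}                   e = contradiction (sym e) (↑ˡ≢↑ʳ i j')
      g-injective {suc (suc (suc zero))}   {suc (suc zero)}         e = contradiction (sym e) (↑ˡ≢↑ʳ i' j')

  module _ {t k} (f : Coloring (n + m) t) (tree : TreeColoring (K n m) k f) (c : Fin t) where

    private
      a b : ℕ
      a = classSize (onLeft f) c
      b = classSize (onRight f) c
      colored-c : ∀ {N} → Coloring N t → Fin N → Bool
      colored-c g v = ⌊ g v Finₚ.≟ c ⌋

    left-part≥1⇒right-part≤k : 1 ≤ a → b ≤ k
    left-part≥1⇒right-part≤k 1≤a with count-witness (colored-c (onLeft f)) 1≤a
    ... | i , i-colored = begin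
      b                                      ≡⟨ cong (classSize (onRight f)) (toWitness i-colored) ⟨
      classSize (onRight f) (f (i ↑ˡ m))     ≡⟨ degIn-↑ˡ f i ⟨
      degIn (K n m) f (i ↑ˡ m)               ≤⟨ proj₂ tree (i ↑ˡ m) ⟩
      k                                      ∎
      where open ≤-Reasoning

    right-part≥1⇒left-part≤k : 1 ≤ b → a ≤ k
    right-part≥1⇒left-part≤k 1≤b with count-witness (colored-c (onRight f)) 1≤b
    ... | j , j-colored = begin
      a                                      ≡⟨ cong (classSize (onLeft f)) (toWitness j-colored) ⟨
      classSize (onLeft f) (f (n ↑ʳ j))      ≡⟨ degIn-↑ʳ f j ⟨
      degIn (K n m) f (n ↑ʳ j)               ≤⟨ proj₂ tree (n ↑ʳ j) ⟩
      k                                      ∎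
      where open ≤-Reasoning

    ¬both-parts≥2 : 2 ≤ a → 2 ≤ b → ⊥
    ¬both-parts≥2 2≤a 2≤b with count-two-witnesses (colored-c (onLeft f)) 2≤a
                             | count-two-witnesses (colored-c (onRight f)) 2≤b
    ... | i , i' , i≢i' , fi , fi' | j , j' , j≢j' , fj , fj' =
      proj₁ tree c (K-4-cycle {S = λ v → f v ≡ c} i≢i' j≢j' (toWitness fi) (toWitness fj) (toWitness fi') (toWitness fj'))

    mixed-class-size≤1+k : 1 ≤ a → 1 ≤ b → a + b ≤ suc k
    mixed-class-size≤1+k 1≤a 1≤b with positive-not-both≥2⇒one≡1 a b 1≤a 1≤b ¬both-parts≥2
    ... | inj₁ a≡1 = subst (λ x → x + b ≤ suc k) (sym a≡1) (s≤s (left-part≥1⇒right-part≤k 1≤a))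
    ... | inj₂ b≡1 = subst (λ y → a + y ≤ suc k) (sym b≡1)
                       (subst (_≤ suc k) (+-comm 1 a) (s≤s (right-part≥1⇒left-part≤k 1≤b)))

    large-class-one-sided : 2 + k ≤ classSize f c → a ≡ 0 ⊎ b ≡ 0
    large-class-one-sided 2+k≤size with a ≟ 0 | b ≟ 0
    ... | yes a≡0 | _       = inj₁ a≡0
    ... | no  _   | yes b≡0 = inj₂ b≡0
    ... | no  a≢0 | no  b≢0 = contradiction
      (subst (2 + k ≤_) (classSize-split f c) 2+k≤size)
      (<⇒≱ (s≤s (mixed-class-size≤1+k (n≢0⇒n>0 a≢0) (n≢0⇒n>0 b≢0))))

open CompleteBipartite

K₃,₄-has-no-eq-tree-1-coloring : ¬ HasEqTreeColoring (K 3 4) 1 2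
K₃,₄-has-no-eq-tree-1-coloring (f , _ , tree)
  with large-class-one-sided 3 4 f tree zero (subst (4 ≤_) (sym (classSize-of-1-coloring f)) (m≤m+n 4 3))
... | inj₁ left≡0  = contradiction (trans (sym (classSize-of-1-coloring (onLeft 3 4 f))) left≡0) λ ()
... | inj₂ right≡0 = contradiction (trans (sym (classSize-of-1-coloring (onRight 3 4 f))) right≡0) λ ()

data FourFiveSum : ℕ → Set where
  ∅     : FourFiveSum 0
  four+ : ∀ {s} → FourFiveSum s → FourFiveSum (4 + s)
  five+ : ∀ {s} → FourFiveSum s → FourFiveSum (5 + s)

FourFiveSum-+ : ∀ {r s} → FourFiveSum r → FourFiveSum s → FourFiveSum (r + s)
FourFiveSum-+ ∅         s = s
FourFiveSum-+ (four+ r) s = four+ (FourFiveSum-+ r s)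
FourFiveSum-+ (five+ r) s = five+ (FourFiveSum-+ r s)

∑-FourFiveSum : ∀ {k} {g : Fin k → ℕ} → (∀ i → FourFiveSum (g i)) → FourFiveSum (∑ g)
∑-FourFiveSum {zero}  _ = ∅
∑-FourFiveSum {suc k} g = FourFiveSum-+ (g zero) (∑-FourFiveSum (g ∘ suc))

4-or-5⇒FourFiveSum : ∀ {s} → s ≡ 4 ⊎ s ≡ 5 → FourFiveSum s
4-or-5⇒FourFiveSum (inj₁ refl) = four+ ∅
4-or-5⇒FourFiveSum (inj₂ refl) = five+ ∅

4-or-5⇒4≤ : ∀ {s} → s ≡ 4 ⊎ s ≡ 5 → 4 ≤ s
4-or-5⇒4≤ (inj₁ refl) = ≤-refl
4-or-5⇒4≤ (inj₂ refl) = n≤1+n 4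

¬FourFiveSum-6 : ¬ FourFiveSum 6
¬FourFiveSum-6 (four+ ())
¬FourFiveSum-6 (five+ ())

equitable-3-coloring-of-13 : (f : Coloring 13 3) → Equitable f → ∀ c → classSize f c ≡ 4 ⊎ classSize f c ≡ 5
equitable-3-coloring-of-13 f equitable c = four-or-five (classSize f c) lower upper
  where
    lower : 13 ≤ 3 * suc (classSize f c)
    lower = proj₁ (equitable⇒classSize-bounds f equitable c)
    upper : 3 * classSize f c ≤ 16
    upper = proj₂ (equitable⇒classSize-bounds f equitable c)
    -- `≤⇒≤ᵇ` sends a false inequality between numerals to `T false`, which is ⊥.
    four-or-five : ∀ s → 13 ≤ 3 * suc s → 3 * s ≤ 16 → s ≡ 4 ⊎ s ≡ 5
    four-or-five 0 13≤ _ = ⊥-elim (≤⇒≤ᵇ 13≤)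
    four-or-five 1 13≤ _ = ⊥-elim (≤⇒≤ᵇ 13≤)
    four-or-five 2 13≤ _ = ⊥-elim (≤⇒≤ᵇ 13≤)
    four-or-five 3 13≤ _ = ⊥-elim (≤⇒≤ᵇ 13≤)
    four-or-five 4 _   _ = inj₁ refl
    four-or-five 5 _   _ = inj₂ refl
    four-or-five (suc (suc (suc (suc (suc (suc k)))))) _ ≤16 =
      ⊥-elim (≤⇒≤ᵇ (≤-trans (*-monoʳ-≤ 3 (m≤m+n 6 k)) ≤16))

K₆,₇-has-no-eq-tree-3-coloring : ¬ HasEqTreeColoring (K 6 7) 3 2
K₆,₇-has-no-eq-tree-3-coloring (f , equitable , tree) =
  ¬FourFiveSum-6 (subst FourFiveSum (∑-classSize (onLeft 6 7 f)) (∑-FourFiveSum left-part))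
  where
    size : ∀ c → classSize f c ≡ 4 ⊎ classSize f c ≡ 5
    size = equitable-3-coloring-of-13 f equitable

    left-part : ∀ c → FourFiveSum (classSize (onLeft 6 7 f) c)
    left-part c = [ (λ left≡0 → subst FourFiveSum (sym left≡0) ∅)
                  , (λ right≡0 → subst FourFiveSum (left≡size right≡0) (4-or-5⇒FourFiveSum (size c)))
                  ]′ (large-class-one-sided 6 7 f tree c (4-or-5⇒4≤ (size c)))
      where
        left≡size : classSize (onRight 6 7 f) c ≡ 0 → classSize f c ≡ classSize (onLeft 6 7 f) c
        left≡size right≡0 = trans (classSize-split 6 7 f c)
          (trans (cong (classSize (onLeft 6 7 f) c +_) right≡0) (+-identityʳ _))

K₃,₄-AllFrom-2 : AllFrom (K 3 4) 2 2
K₃,₄-AllFrom-2 0 ()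
K₃,₄-AllFrom-2 1 (s≤s ())
K₃,₄-AllFrom-2 2 _ = coloringTable (K 3 4) 2 (# 0 ∷ # 0 ∷ # 0 ∷ # 1 ∷ # 1 ∷ # 1 ∷ # 1 ∷ [])
K₃,₄-AllFrom-2 3 _ = coloringTable (K 3 4) 2 (# 0 ∷ # 0 ∷ # 0 ∷ # 1 ∷ # 1 ∷ # 2 ∷ # 2 ∷ [])
K₃,₄-AllFrom-2 4 _ = coloringTable (K 3 4) 2 (# 0 ∷ # 0 ∷ # 3 ∷ # 1 ∷ # 1 ∷ # 2 ∷ # 2 ∷ [])
K₃,₄-AllFrom-2 5 _ = coloringTable (K 3 4) 2 (# 0 ∷ # 0 ∷ # 2 ∷ # 1 ∷ # 1 ∷ # 3 ∷ # 4 ∷ [])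
K₃,₄-AllFrom-2 6 _ = coloringTable (K 3 4) 2 (# 0 ∷ # 0 ∷ # 1 ∷ # 2 ∷ # 3 ∷ # 4 ∷ # 5 ∷ [])
K₃,₄-AllFrom-2 (suc (suc (suc (suc (suc (suc (suc k))))))) _ =
  hasEqTreeColoring-≥ (K 3 4) (K-loopless 3 4) 2 (m≤m+n 7 k)

K₆,₇-AllFrom-4 : AllFrom (K 6 7) 2 4
K₆,₇-AllFrom-4 0  ()
K₆,₇-AllFrom-4 1  (s≤s ())
K₆,₇-AllFrom-4 2  (s≤s (s≤s ()))
K₆,₇-AllFrom-4 3  (s≤s (s≤s (s≤s ())))
K₆,₇-AllFrom-4 4  _ = coloringTable (K 6 7) 2 (# 0 ∷ # 0 ∷ # 0 ∷ # 1 ∷ # 1 ∷ # 1 ∷ # 2 ∷ # 2 ∷ # 2 ∷ # 2 ∷ # 3 ∷ # 3 ∷ # 3 ∷ [])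
K₆,₇-AllFrom-4 5  _ = coloringTable (K 6 7) 2 (# 0 ∷ # 0 ∷ # 0 ∷ # 1 ∷ # 1 ∷ # 1 ∷ # 2 ∷ # 2 ∷ # 2 ∷ # 3 ∷ # 3 ∷ # 4 ∷ # 4 ∷ [])
K₆,₇-AllFrom-4 6  _ = coloringTable (K 6 7) 2 (# 0 ∷ # 0 ∷ # 1 ∷ # 1 ∷ # 2 ∷ # 2 ∷ # 3 ∷ # 3 ∷ # 3 ∷ # 4 ∷ # 4 ∷ # 5 ∷ # 5 ∷ [])
K₆,₇-AllFrom-4 7  _ = coloringTable (K 6 7) 2 (# 0 ∷ # 0 ∷ # 1 ∷ # 1 ∷ # 2 ∷ # 2 ∷ # 3 ∷ # 3 ∷ # 4 ∷ # 4 ∷ # 5 ∷ # 5 ∷ # 6 ∷ [])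
K₆,₇-AllFrom-4 8  _ = coloringTable (K 6 7) 2 (# 0 ∷ # 0 ∷ # 1 ∷ # 1 ∷ # 2 ∷ # 2 ∷ # 3 ∷ # 3 ∷ # 4 ∷ # 4 ∷ # 5 ∷ # 6 ∷ # 7 ∷ [])
K₆,₇-AllFrom-4 9  _ = coloringTable (K 6 7) 2 (# 0 ∷ # 0 ∷ # 1 ∷ # 1 ∷ # 2 ∷ # 2 ∷ # 3 ∷ # 3 ∷ # 4 ∷ # 5 ∷ # 6 ∷ # 7 ∷ # 8 ∷ [])
K₆,₇-AllFrom-4 10 _ = coloringTable (K 6 7) 2 (# 0 ∷ # 0 ∷ # 1 ∷ # 1 ∷ # 2 ∷ # 2 ∷ # 3 ∷ # 4 ∷ # 5 ∷ # 6 ∷ # 7 ∷ # 8 ∷ # 9 ∷ [])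
K₆,₇-AllFrom-4 11 _ = coloringTable (K 6 7) 2 (# 0 ∷ # 0 ∷ # 1 ∷ # 1 ∷ # 2 ∷ # 3 ∷ # 4 ∷ # 5 ∷ # 6 ∷ # 7 ∷ # 8 ∷ # 9 ∷ # 10 ∷ [])
K₆,₇-AllFrom-4 12 _ = coloringTable (K 6 7) 2 (# 0 ∷ # 0 ∷ # 1 ∷ # 2 ∷ # 3 ∷ # 4 ∷ # 5 ∷ # 6 ∷ # 7 ∷ # 8 ∷ # 9 ∷ # 10 ∷ # 11 ∷ [])
K₆,₇-AllFrom-4 (suc (suc (suc (suc (suc (suc (suc (suc (suc (suc (suc (suc (suc k))))))))))))) _ =
  hasEqTreeColoring-≥ (K 6 7) (K-loopless 6 7) 2 (m≤m+n 13 k)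

proposition2p1 : (t : ℕ) → 1 ≤ t → t ≤ 2 →
    IsStrongEqVA (K (3 * t) (suc (3 * t))) 2 (2 * ((3 * t + 2) / 3))
proposition2p1 0 () _
proposition2p1 1 _ _ = s≤s z≤n , K₃,₄-AllFrom-2 , below-2
  where
    below-2 : ∀ t' → 1 ≤ t' → t' < 2 → ¬ AllFrom (K 3 4) 2 t'
    below-2 1 _ _ allFrom = K₃,₄-has-no-eq-tree-1-coloring (allFrom 1 ≤-refl)
    below-2 (suc (suc _)) _ (s≤s (s≤s ()))
proposition2p1 2 _ _ = s≤s z≤n , K₆,₇-AllFrom-4 , below-4
  where
    below-4 : ∀ t' → 1 ≤ t' → t' < 4 → ¬ AllFrom (K 6 7) 2 t'
    below-4 _ _ t'<4 allFrom = K₆,₇-has-no-eq-tree-3-coloring (allFrom 3 (s≤s⁻¹ t'<4))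
proposition2p1 (suc (suc (suc _))) _ (s≤s (s≤s ()))
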